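{- Let $G$ be a finite abelian group and $k$ a positive integer. For every $n\in\mathbb{N}$, the largest subset of $(G^n)^{\times k}$ containing no nontrivial $k$-dimensional corner has size at least $\frac{k\,|G|^{kn}}{|G|^{n/k}(k+1)^{(k+1)/k}}$. As a consequence, $\Theta(H_{k,\mathrm{cor},G})\geq |G|^{k-1/k}$.
   Context: For an abelian group $A$, a nontrivial $k$-dimensional corner in $A^{\times k}$ is a set $\{(x_1,\dots,x_k),(x_1+\lambda,x_2,\dots,x_k),\dots,(x_1,\dots,x_{k-1},x_k+\lambda)\}$ with $x_i,\lambda\in A$, $\lambda\neq 0$. $H_{k,\mathrm{cor},G}$ is the directed $(k+1)$-uniform hypergraph with vertex set $G^{\times k}$ and edges $((x_1,\dots,x_k),(x_1+\lambda,x_2,\dots,x_k),\dots,(x_1,\dots,x_k+\lambda))$ for all $x_i,\lambda\in G$ with $\lambda\neq0$. A directed $m$-uniform hypergraph is a pair $(V,E)$ with $V$ finite and $E$ a set of $m$-tuples of elements of $V$. The strong product of $(V_G,E_G)$ and $(V_H,E_H)$ has vertices $V_G\times V_H$, and $((g_1,h_1),\dots,(g_m,h_m))$ is an edge iff ($g_1=\dots=g_m$ and $(h_i)_i\in E_H$) or ($(g_i)_i\in E_G$ and $h_1=\dots=h_m$) or ($(g_i)_i\in E_G$ and $(h_i)_i\in E_H$). $H^{\boxtimes n}$ is the $n$-fold strong product. An independent set is a vertex set containing no edge entirely; $\alpha(H)$ is the maximum size of an independent set and $\Theta(H)=\lim_{n\to\infty}\alpha(H^{\boxtimes n})^{1/n}$.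 -}

module Defs where

open import Data.Nat using (ℕ; zero; suc)
open import Data.Fin using (Fin; zero; suc)
open import Data.Vec using (Vec; zipWith; replicate; updateAt)
open import Data.List using (List)
open import Data.List.Membership.Propositional using (_∈_)
open import Data.Product using (Σ; ∃; _×_; _,_; proj₁; proj₂)
open import Data.Sum using (_⊎_)
open import Data.Unit using (⊤)
open import Data.Empty using (⊥)
open import Relation.Nullary using (¬_)
open import Relation.Binary.PropositionalEquality using (_≡_; _≢_)
open import Algebra.Structures using (IsAbelianGroup)

-- A finite abelian group of order m, presented on the carrier Fin m
-- (every finite abelian group of order m is isomorphic to such a one).
record FinAbGroup (m : ℕ) : Set where
  field
    _∙_ : Fin m → Fin m → Fin m
    ε : Fin m
    _⁻¹ : Fin m → Fin m
    isAbelianGroup : IsAbelianGroup _≡_ _∙_ ε _⁻¹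

module _ {m : ℕ} (G : FinAbGroup m) where
  open FinAbGroup G

  _⊕ⁿ_ : {n : ℕ} → Vec (Fin m) n → Vec (Fin m) n → Vec (Fin m) n
  _⊕ⁿ_ = zipWith _∙_

  0ⁿ : (n : ℕ) → Vec (Fin m) n
  0ⁿ n = replicate n ε

shift : {A : Set} → (A → A → A) → {k : ℕ} → Vec A k → Fin k → A → Vec A k
shift _+_ x i λ′ = updateAt x i (λ a → a + λ′)

cornerTuple : {A : Set} → (A → A → A) → {k : ℕ} → Vec A k → A → Fin (suc k) → Vec A k
cornerTuple _+_ x λ′ zero = x
cornerTuple _+_ x λ′ (suc i) = shift _+_ x i λ′

ContainsCorner : {A : Set} → (A → A → A) → A → (k : ℕ) → List (Vec A k) → Set
ContainsCorner _+_ 0A k S =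
  Σ (Vec _ k) λ x → Σ _ λ λ′ → (λ′ ≢ 0A) × (∀ i → cornerTuple _+_ x λ′ i ∈ S)

CornerFree : {A : Set} → (A → A → A) → A → (k : ℕ) → List (Vec A k) → Set
CornerFree _+_ 0A k S = ¬ ContainsCorner _+_ 0A k S

-- Directed r-uniform hypergraphs: edges are r-tuples (Fin r → V) satisfying E.
record Hypergraph (r : ℕ) : Set₁ where
  field
    V : Set
    E : (Fin r → V) → Set
open Hypergraph public

Hcor : {m : ℕ} → FinAbGroup m → (k : ℕ) → Hypergraph (suc k)
Hcor {m} G k = record
  { V = Vec (Fin m) k
  ; E = λ e → Σ (Vec (Fin m) k) λ x → Σ (Fin m) λ λ′ →
          (λ′ ≢ FinAbGroup.ε G) × (∀ i → e i ≡ cornerTuple (FinAbGroup._∙_ G) x λ′ i)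
  }

AllEqual : {r : ℕ} {X : Set} → (Fin r → X) → Set
AllEqual t = ∀ i j → t i ≡ t j

_⊠_ : {r : ℕ} → Hypergraph r → Hypergraph r → Hypergraph r
HG ⊠ HH = record
  { V = V HG × V HH
  ; E = λ e → (AllEqual (λ i → proj₁ (e i)) × E HH (λ i → proj₂ (e i)))
            ⊎ ((E HG (λ i → proj₁ (e i)) × AllEqual (λ i → proj₂ (e i)))
            ⊎ (E HG (λ i → proj₁ (e i)) × E HH (λ i → proj₂ (e i))))
  }

unitH : {r : ℕ} → Hypergraph r
unitH = record { V = ⊤ ; E = λ _ → ⊥ }

_^⊠_ : {r : ℕ} → Hypergraph r → ℕ → Hypergraph r
H ^⊠ zero = unitH
H ^⊠ suc n = (H ^⊠ n) ⊠ H

Independent : {r : ℕ} (H : Hypergraph r) → List (V H) → Set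
Independent H S = ∀ e → E H e → ¬ (∀ i → e i ∈ S)

-- Deletion method.  Keep each point of (G^n)^k independently with probability p.  With
-- M = |G|^n there are N = M^k points and N (M - 1) nontrivial corners, each a set of
-- k + 1 distinct points, so deleting one point from every corner that survives leaves a
-- corner-free set of expected size at least N p - N (M - 1) p^(k+1); for p^k close to
-- 1 / (M (k+1)) this is k N / (M^(1/k) (k+1)^((k+1)/k)).  Over ℕ the expectation is an
-- exact weighted sum over all subsets with p = a / (a + d), and some subset does at
-- least as well as the average.  Finally (G^n)^k is the vertex set of the n-th strong
-- power of H_{k,cor,G}, every edge of which comes from a corner, so these corner-free
-- sets are independent sets of size about |G|^((k - 1/k) n).

module Submission where

open import Defs
open import Data.Nat using (ℕ; suc; _+_; _*_; _^_; _∸_; _≤_; _<_)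
open import Data.Fin using (Fin)
open import Data.Vec using (Vec)
open import Data.List using (List; length)
open import Data.List.Relation.Unary.Unique.Propositional using (Unique)
open import Data.Product using (Σ; ∃; _×_)

open import Algebra.Bundles using (Group)
open import Algebra.Structures using (IsAbelianGroup)
import Algebra.Properties.Group as GroupProperties
open import Data.Fin using (zero; suc)
open import Data.Fin.Properties using (nonZeroIndex)
import Data.Fin.Properties as Fin
open import Data.List using ([]; _∷_; map; filter; tabulate; cartesianProductWith; cartesianProduct; allFin)
open import Data.List.Properties
  using (filter-accept; filter-reject; filter-all; length-++; length-map; length-tabulate)
open import Data.List.Membership.Propositional using (_∈_; _∉_; find; lose)
open import Data.List.Membership.Propositional.Properties
  using (∈-filter⁺; ∈-filter⁻; ∈-map⁻; ∈-tabulate⁻; ∈-allFin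
        ; ∈-cartesianProductWith⁺; ∈-cartesianProduct⁺; ∈-cartesianProduct⁻)
open import Data.List.Relation.Binary.Subset.Propositional using (_⊆_)
open import Data.List.Relation.Binary.Subset.Propositional.Properties
  using (⊆-trans; xs⊆x∷xs; ∷⁺ʳ; ⊆∷∧∉⇒⊆; filter-⊆)
open import Data.List.Relation.Unary.All using ([])
import Data.List.Relation.Unary.All as All
open import Data.List.Relation.Unary.AllPairs using ([]; _∷_)
open import Data.List.Relation.Unary.Any using (here; there; any?)
open import Data.List.Relation.Unary.Unique.Propositional.Properties
  using (filter⁺; map⁺; tabulate⁺; allFin⁺; cartesianProductWith⁺)
open import Data.Nat using (zero; z≤n; s≤s; NonZero; >-nonZero; >-nonZero⁻¹; _≤?_; _<?_)
open import Data.Nat.Induction using (<-wellFounded)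
open import Data.Nat.Properties
open import Algebra.Properties.CommutativeSemigroup *-commutativeSemigroup
  using (x∙yz≈y∙xz; x∙yz≈y∙zx; xy∙z≈y∙xz; xy∙z≈xz∙y)
open import Data.Nat.Tactic.RingSolver using (solve-∀)
open import Data.Product using (_,_; proj₁; proj₂; ∃-syntax)
open import Data.Sum using (inj₁; inj₂)
open import Data.Unit using (tt)
open import Data.Vec using ([]; _∷_)
import Data.Vec as Vec
import Data.Vec.Properties as Vecₚ
open import Function using (_∘_)
open import Function.Definitions using (Injective)
open import Induction.WellFounded using (Acc; acc)
open import Level using (0ℓ)
open import Relation.Binary.Definitions using (DecidableEquality)
open import Relation.Binary.PropositionalEquality
open import Relation.Nullary using (¬_; Dec; yes; no; contradiction)
open import Relation.Nullary.Decidable using (¬?)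
open import Relation.Unary using (Decidable)

-- Arithmetic

^-distribʳ-* : ∀ x y n → (x * y) ^ n ≡ x ^ n * y ^ n
^-distribʳ-* x y zero = refl
^-distribʳ-* x y (suc n) = begin
  x * y * (x * y) ^ n     ≡⟨ cong (x * y *_) (^-distribʳ-* x y n) ⟩
  x * y * (x ^ n * y ^ n) ≡⟨ interchange x y (x ^ n) (y ^ n) ⟩
  x * x ^ n * (y * y ^ n) ∎
  where
  open ≡-Reasoning
  interchange : ∀ x y u v → x * y * (u * v) ≡ x * u * (y * v)
  interchange = solve-∀

^-comm-^ : ∀ x n k → (x ^ n) ^ k ≡ (x ^ k) ^ n
^-comm-^ x n k = begin
  (x ^ n) ^ k ≡⟨ ^-*-assoc x n k ⟩
  x ^ (n * k) ≡⟨ cong (x ^_) (*-comm n k) ⟩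
  x ^ (k * n) ≡⟨ ^-*-assoc x k n ⟨
  (x ^ k) ^ n ∎
  where open ≡-Reasoning

bernoulli : ∀ u v j → u ^ j * (u + suc j * v) ≤ (u + v) ^ suc j
bernoulli u v zero = ≤-reflexive (ring u v)
  where
  ring : ∀ u v → 1 * (u + (v + 0)) ≡ (u + v) * 1
  ring = solve-∀
bernoulli u v (suc j) = begin
  u * w * (u + (2 + j) * v)                                  ≡⟨ ring u v w j ⟩
  u * (w * (u + suc j * v)) + v * (w * u)                    ≤⟨ +-monoʳ-≤ _ (*-monoʳ-≤ v (*-monoʳ-≤ w (m≤m+n u _))) ⟩
  u * (w * (u + suc j * v)) + v * (w * (u + suc j * v))      ≡⟨ *-distribʳ-+ (w * (u + suc j * v)) u v ⟨
  (u + v) * (w * (u + suc j * v))                            ≤⟨ *-monoʳ-≤ (u + v) (bernoulli u v j) ⟩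
  (u + v) * (u + v) ^ suc j                                  ∎
  where
  open ≤-Reasoning
  w = u ^ j
  ring : ∀ u v w j → u * w * (u + (2 + j) * v) ≡ u * (w * (u + (1 + j) * v)) + v * (w * u)
  ring = solve-∀

suc-^-≤ : ∀ a j → suc a ^ suc j ≤ a ^ suc j + suc j * suc a ^ j
suc-^-≤ a zero = ≤-reflexive (ring a)
  where
  ring : ∀ a → (1 + a) * 1 ≡ a * 1 + (1 + 0) * 1
  ring = solve-∀
suc-^-≤ a (suc j) = begin
  suc a * (suc a * R)                             ≤⟨ *-monoʳ-≤ (suc a) (suc-^-≤ a j) ⟩
  suc a * (a * S + suc j * R)                     ≡⟨ ring a S R j ⟩
  a * (a * S) + (a * S + suc j * (suc a * R))     ≤⟨ +-monoʳ-≤ (a * (a * S)) (+-monoˡ-≤ _ aS≤sucaR) ⟩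
  a * (a * S) + (suc a * R + suc j * (suc a * R)) ∎
  where
  open ≤-Reasoning
  R = suc a ^ j
  S = a ^ j
  aS≤sucaR : a * S ≤ suc a * R
  aS≤sucaR = *-mono-≤ (n≤1+n a) (^-monoˡ-≤ j (n≤1+n a))
  ring : ∀ a S R j → (1 + a) * (a * S + (1 + j) * R) ≡ a * (a * S) + (a * S + (1 + j) * ((1 + a) * R))
  ring = solve-∀

suc-^-ratio : ∀ r j a → suc r * suc j ≤ a → r * suc a ^ suc j ≤ suc r * a ^ suc j
suc-^-ratio r j a ck≤a = *-cancelˡ-≤ a {{a≢0}} (+-cancelʳ-≤ (c * suc k * R) _ _ (begin
  a * (r * R) + c * suc k * R ≡⟨ ring₁ a r R c (suc k) ⟩
  (r * a + c * suc k) * R     ≤⟨ *-monoˡ-≤ R coefficients ⟩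
  c * suc a * R               ≡⟨ *-assoc c (suc a) R ⟩
  c * (suc a * R)             ≤⟨ *-monoʳ-≤ c (suc-^-≤ a k) ⟩
  c * (a * S + suc k * R)     ≡⟨ ring₂ a c S (suc k) R ⟩
  a * (c * S) + c * suc k * R ∎))
  where
  open ≤-Reasoning
  c = suc r
  k = suc j
  R = suc a ^ k
  S = a ^ k
  a≢0 : NonZero a
  a≢0 = >-nonZero (≤-trans (s≤s z≤n) ck≤a)
  coefficients : r * a + c * suc k ≤ c * suc a
  coefficients = begin
    r * a + c * suc k   ≡⟨ cong (r * a +_) (*-suc c k) ⟩
    r * a + (c + c * k) ≤⟨ +-monoʳ-≤ (r * a) (+-monoʳ-≤ c ck≤a) ⟩
    r * a + (c + a)     ≡⟨ ring₃ r a ⟩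
    c * suc a           ∎
    where
    ring₃ : ∀ r a → r * a + ((1 + r) + a) ≡ (1 + r) * (1 + a)
    ring₃ = solve-∀
  ring₁ : ∀ a r R c s → a * (r * R) + c * s * R ≡ (r * a + c * s) * R
  ring₁ = solve-∀
  ring₂ : ∀ a c S s R → c * (a * S + s * R) ≡ a * (c * S) + c * s * R
  ring₂ = solve-∀

^-cancelˡ-≤ : ∀ n .{{_ : NonZero n}} {a b} → a ^ n ≤ b ^ n → a ≤ b
^-cancelˡ-≤ n {a} {b} aⁿ≤bⁿ with a ≤? b
... | yes a≤b = a≤b
... | no a≰b = contradiction aⁿ≤bⁿ (<⇒≱ (^-monoˡ-< n (≰⇒> a≰b)))

^-cancelˡ-< : ∀ n {a b} → a ^ n < b ^ n → a < b
^-cancelˡ-< n {a} {b} aⁿ<bⁿ with a <? b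
... | yes a<b = a<b
... | no a≮b = contradiction aⁿ<bⁿ (≤⇒≯ (^-monoˡ-≤ n (≮⇒≥ a≮b)))

last-satisfying : {P : ℕ → Set} → Decidable P → ∀ {t B} → P t → (∀ {a} → P a → a ≤ B) →
  ∃[ a ] t ≤ a × P a × ¬ P (suc a)
last-satisfying {P} P? {t} {B} Pt bounded = search (suc B) t ≤-refl Pt (≤-trans (s≤s (m≤n+m B t)) (≤-reflexive (sym (+-suc t B))))
  where
  search : ∀ gap a → t ≤ a → P a → B < a + gap → ∃[ a ] t ≤ a × P a × ¬ P (suc a)
  search zero a _ Pa B<a = contradiction (bounded Pa) (<⇒≱ (subst (B <_) (+-identityʳ a) B<a))
  search (suc gap) a t≤a Pa B<a+gap with P? (suc a)
  ... | no ¬Pa+1 = a , t≤a , Pa , ¬Pa+1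
  ... | yes Pa+1 = search gap (suc a) (m≤n⇒m≤1+n t≤a) Pa+1 (subst (B <_) (+-suc a gap) B<a+gap)

-- a / b approximates c^(-1/k) from below, with a ≥ t as large as desired.
pow-bracket : ∀ c j t → 1 ≤ c → 1 ≤ t →
  ∃[ a ] ∃[ b ] 1 ≤ b × t ≤ a × c * a ^ suc j ≤ b ^ suc j × b ^ suc j < c * suc a ^ suc j
pow-bracket c j t 1≤c 1≤t =
  let (a , t≤a , lower , upper) = last-satisfying (λ a → c * a ^ k ≤? B) ctk≤B bounded
  in a , c * t , *-mono-≤ 1≤c 1≤t , t≤a , lower , ≰⇒> upper
  where
  k = suc j
  B = (c * t) ^ k
  ctk≤B : c * t ^ k ≤ B
  ctk≤B = subst (c * t ^ k ≤_) (sym (^-distribʳ-* c t k))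
            (*-monoˡ-≤ (t ^ k) (m≤m*n c (c ^ j) {{>-nonZero (m^n>0 c {{>-nonZero 1≤c}} j)}}))
  bounded : ∀ {a} → c * a ^ k ≤ B → a ≤ B
  bounded {zero} _ = z≤n
  bounded {suc a} cak≤B =
    ≤-trans (m≤m*n (suc a) (suc a ^ j) {{>-nonZero (m^n>0 (suc a) j)}})
      (≤-trans (m≤n*m (suc a ^ k) c {{>-nonZero 1≤c}}) cak≤B)

ceiling-multiple : ∀ Z B → 1 ≤ B → ∃[ L ] Z ≤ L * B × L * B < Z + B
ceiling-multiple zero B 1≤B = 0 , z≤n , 1≤B
ceiling-multiple (suc Z) B 1≤B with ceiling-multiple Z B 1≤B
... | L , Z≤LB , LB<Z+B with suc Z ≤? L * B
...   | yes Z<LB = L , Z<LB , m<n⇒m<1+n LB<Z+B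
...   | no Z≮LB = suc L , subst (suc Z ≤_) (sym next) Z<Z+B , subst (_< suc Z + B) (sym next) ≤-refl
  where
  Z<Z+B : suc Z ≤ Z + B
  Z<Z+B = subst (_≤ Z + B) (+-comm Z 1) (+-monoʳ-≤ Z 1≤B)
  next : suc L * B ≡ Z + B
  next = trans (cong (B +_) (≤-antisym (≤-pred (≰⇒> Z≮LB)) Z≤LB)) (+-comm B Z)

close⇒square-≤ : ∀ r X P → 1 ≤ r → X ≤ P → 2 * r * P ≤ suc (2 * r) * X → r * P * P ≤ X * (r * P + X)
close⇒square-≤ r X P 1≤r X≤P close with m≤n⇒∃[o]m+o≡n X≤P
... | e , refl = begin
  r * (X + e) * (X + e)               ≡⟨ ring₁ r X e ⟩
  X * (r * (X + e)) + r * e * (X + e) ≤⟨ +-monoʳ-≤ _ (*-monoʳ-≤ (r * e) (+-monoʳ-≤ X e≤X)) ⟩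
  X * (r * (X + e)) + r * e * (X + X) ≡⟨ cong (X * (r * (X + e)) +_) (ring₂ r e X) ⟩
  X * (r * (X + e)) + 2 * r * e * X   ≤⟨ +-monoʳ-≤ _ (*-monoˡ-≤ X 2re≤X) ⟩
  X * (r * (X + e)) + X * X           ≡⟨ *-distribˡ-+ X (r * (X + e)) X ⟨
  X * (r * (X + e) + X)               ∎
  where
  open ≤-Reasoning
  2re≤X : 2 * r * e ≤ X
  2re≤X = +-cancelˡ-≤ (2 * r * X) _ _ (subst₂ _≤_ (ring₃ r X e) (ring₄ r X) close)
    where
    ring₃ : ∀ r X e → 2 * r * (X + e) ≡ 2 * r * X + 2 * r * e
    ring₃ = solve-∀
    ring₄ : ∀ r X → suc (2 * r) * X ≡ 2 * r * X + X
    ring₄ = solve-∀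
  e≤X : e ≤ X
  e≤X = ≤-trans (m≤n*m e (2 * r) {{>-nonZero (≤-trans 1≤r (m≤m+n r (r + 0)))}}) 2re≤X
  ring₁ : ∀ r X e → r * (X + e) * (X + e) ≡ X * (r * (X + e)) + r * e * (X + e)
  ring₁ = solve-∀
  ring₂ : ∀ r e X → r * e * (X + X) ≡ 2 * r * e * X
  ring₂ = solve-∀

-- With p^k = Q / P ≈ 1 / (M (k+1)) for the retention probability p and W = P - K Q,
-- the deletion method keeps N p W / P points in expectation; this is the k-th power
-- of (p W / P) ≥ k / (M^(1/k) (k+1)^((k+1)/k)).  The slack K = M - 1 absorbs the
-- error of the approximation of p.
survivor-bound : ∀ K j Q P W → W + K * Q ≡ P →
  Q * (suc K * suc (suc j)) ≤ P → 2 * suc K * P ≤ suc (2 * suc K) * (Q * (suc K * suc (suc j))) →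
  suc j ^ suc j * P ^ suc (suc j) ≤ Q * W ^ suc j * (suc K * suc (suc j) ^ suc (suc j))
survivor-bound K j Q P W W+KQ≡P X≤P close = *-cancelˡ-≤ (M ^ k) {{>-nonZero (m^n>0 M k)}} (begin
  M ^ k * (k ^ k * (P * P ^ k))            ≡⟨ ring₁ (M ^ k) (k ^ k) P (P ^ k) ⟩
  k ^ k * M ^ k * P ^ k * P                ≡⟨ cong (_* P) (sym uᵏ) ⟩
  u * u ^ j * P                            ≡⟨ ring₂ k M P (u ^ j) ⟩
  k * u ^ j * (M * P * P)                  ≤⟨ *-monoʳ-≤ (k * u ^ j) (close⇒square-≤ M X P (s≤s z≤n) X≤P close) ⟩
  k * u ^ j * (X * (M * P + X))            ≡⟨ ring₃ k (u ^ j) X M P ⟩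
  X * (u ^ j * (u + k * X))                ≤⟨ *-monoʳ-≤ X (bernoulli u X j) ⟩
  X * (u + X) ^ k                          ≤⟨ *-monoʳ-≤ X (^-monoˡ-≤ k u+X≤) ⟩
  X * (suc k * M * W) ^ k                  ≡⟨ cong (X *_) vᵏ ⟩
  Q * (M * suc k) * (suc k ^ k * M ^ k * W ^ k) ≡⟨ ring₄ Q M (suc k) (suc k ^ k) (M ^ k) (W ^ k) ⟩
  M ^ k * (Q * W ^ k * (M * (suc k * suc k ^ k))) ∎)
  where
  open ≤-Reasoning
  M = suc K
  k = suc j
  X = Q * (M * suc k)
  u = k * M * P
  u+X≤ : u + X ≤ suc k * M * W
  u+X≤ = +-cancelʳ-≤ (K * X) _ _ (begin
    k * M * P + X + K * X     ≡⟨ +-assoc (k * M * P) X (K * X) ⟩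
    k * M * P + M * X         ≤⟨ +-monoʳ-≤ (k * M * P) (*-monoʳ-≤ M X≤P) ⟩
    k * M * P + M * P         ≡⟨ ring₅ k M P ⟩
    suc k * M * P             ≡⟨ cong (suc k * M *_) W+KQ≡P ⟨
    suc k * M * (W + K * Q)   ≡⟨ ring₆ (suc k) M W K Q ⟩
    suc k * M * W + K * X     ∎)
    where
    ring₅ : ∀ k M P → k * M * P + M * P ≡ (1 + k) * M * P
    ring₅ = solve-∀
    ring₆ : ∀ s M W K Q → s * M * (W + K * Q) ≡ s * M * W + K * (Q * (M * s))
    ring₆ = solve-∀
  uᵏ : u ^ k ≡ k ^ k * M ^ k * P ^ k
  uᵏ = trans (^-distribʳ-* (k * M) P k) (cong (_* P ^ k) (^-distribʳ-* k M k))
  vᵏ : (suc k * M * W) ^ k ≡ suc k ^ k * M ^ k * W ^ k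
  vᵏ = trans (^-distribʳ-* (suc k * M) W k) (cong (_* W ^ k) (^-distribʳ-* (suc k) M k))
  ring₁ : ∀ mk kk P pk → mk * (kk * (P * pk)) ≡ kk * mk * pk * P
  ring₁ = solve-∀
  ring₂ : ∀ k M P uj → k * M * P * uj * P ≡ k * uj * (M * P * P)
  ring₂ = solve-∀
  ring₃ : ∀ k uj X M P → k * uj * (X * (M * P + X)) ≡ X * (uj * (k * M * P + k * X))
  ring₃ = solve-∀
  ring₄ : ∀ Q M s sk mk wk → Q * (M * s) * (sk * mk * wk) ≡ mk * (Q * wk * (M * (s * sk)))
  ring₄ = solve-∀

module DeletionWeights (K j : ℕ) where
  M k c : ℕ
  M = suc K
  k = suc j
  c = M * suc k

  bracket⇒close : ∀ a b → suc (2 * M) * k ≤ a → b ^ k < c * suc a ^ k → 2 * M * b ^ k ≤ suc (2 * M) * (a ^ k * c)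
  bracket⇒close a b a-large upper = begin
    2 * M * b ^ k                 ≤⟨ *-monoʳ-≤ (2 * M) (<⇒≤ upper) ⟩
    2 * M * (c * suc a ^ k)       ≡⟨ x∙yz≈y∙xz (2 * M) c (suc a ^ k) ⟩
    c * (2 * M * suc a ^ k)       ≤⟨ *-monoʳ-≤ c (suc-^-ratio (2 * M) j a a-large) ⟩
    c * (suc (2 * M) * a ^ k)     ≡⟨ x∙yz≈y∙zx c (suc (2 * M)) (a ^ k) ⟩
    suc (2 * M) * (a ^ k * c)     ∎
    where open ≤-Reasoning

  weights-from-bracket : ∀ N a d → 1 ≤ a + d → suc (2 * M) * k ≤ a →
    c * a ^ k ≤ (a + d) ^ k → (a + d) ^ k < c * suc a ^ k →
    ∃[ L ] L * (a + d) ^ suc k + N * K * a ^ suc k < (a + d) ^ suc k + N * a * (a + d) ^ k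
         × k ^ k * N ^ k ≤ L ^ k * (M * suc k ^ suc k)
  weights-from-bracket N a d 1≤b a-large lower upper =
    let (L , NaW≤LB , LB<NaW+B) = ceiling-multiple (N * a * W) B (m^n>0 b (suc k))
    in L , gain L LB<NaW+B , size L NaW≤LB
    where
    b = a + d
    instance
      b≢0 : NonZero b
      b≢0 = >-nonZero 1≤b
    Q = a ^ k
    P = b ^ k
    B = b ^ suc k
    X≤P : Q * c ≤ P
    X≤P = subst (_≤ P) (*-comm c Q) lower
    KQ≤P : K * Q ≤ P
    KQ≤P = ≤-trans (≤-trans (*-monoˡ-≤ Q (≤-trans (n≤1+n K) (m≤m*n M (suc k)))) (≤-reflexive (*-comm c Q))) X≤P
    W = P ∸ K * Q
    W+KQ≡P : W + K * Q ≡ P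
    W+KQ≡P = m∸n+n≡m KQ≤P
    gain : ∀ L → L * B < N * a * W + B → L * B + N * K * (a * Q) < B + N * a * P
    gain L LB<NaW+B = begin-strict
      L * B + N * K * (a * Q)             <⟨ +-monoˡ-< (N * K * (a * Q)) LB<NaW+B ⟩
      N * a * W + B + N * K * (a * Q)     ≡⟨ ring₁ (N * a * W) B (N * K * (a * Q)) ⟩
      B + (N * a * W + N * K * (a * Q))   ≡⟨ cong (B +_) (ring₂ N a W K Q) ⟩
      B + N * a * (W + K * Q)             ≡⟨ cong (λ z → B + N * a * z) W+KQ≡P ⟩
      B + N * a * P                       ∎
      where
      open ≤-Reasoning
      ring₁ : ∀ x y z → x + y + z ≡ y + (x + z)
      ring₁ = solve-∀
      ring₂ : ∀ N a W K Q → N * a * W + N * K * (a * Q) ≡ N * a * (W + K * Q)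
      ring₂ = solve-∀
    size : ∀ L → N * a * W ≤ L * B → k ^ k * N ^ k ≤ L ^ k * (M * suc k ^ suc k)
    size L NaW≤LB = *-cancelʳ-≤ _ _ (P ^ suc k) {{m^n≢0 P (suc k) {{m^n≢0 b k}}}} (begin
      k ^ k * N ^ k * P ^ suc k               ≡⟨ xy∙z≈y∙xz (k ^ k) (N ^ k) (P ^ suc k) ⟩
      N ^ k * (k ^ k * P ^ suc k)             ≤⟨ *-monoʳ-≤ (N ^ k) survivors ⟩
      N ^ k * (Q * W ^ k * (M * suc k ^ suc k)) ≡⟨ *-assoc (N ^ k) (Q * W ^ k) _ ⟨
      N ^ k * (Q * W ^ k) * (M * suc k ^ suc k) ≡⟨ cong (_* (M * suc k ^ suc k)) NaWᵏ ⟨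
      (N * a * W) ^ k * (M * suc k ^ suc k)   ≤⟨ *-monoˡ-≤ (M * suc k ^ suc k) (^-monoˡ-≤ k NaW≤LB) ⟩
      (L * B) ^ k * (M * suc k ^ suc k)       ≡⟨ cong (_* (M * suc k ^ suc k)) (^-distribʳ-* L B k) ⟩
      L ^ k * B ^ k * (M * suc k ^ suc k)     ≡⟨ cong (λ z → L ^ k * z * (M * suc k ^ suc k)) (^-comm-^ b (suc k) k) ⟩
      L ^ k * P ^ suc k * (M * suc k ^ suc k) ≡⟨ xy∙z≈xz∙y (L ^ k) (P ^ suc k) (M * suc k ^ suc k) ⟩
      L ^ k * (M * suc k ^ suc k) * P ^ suc k ∎)
      where
      open ≤-Reasoning
      survivors : k ^ k * P ^ suc k ≤ Q * W ^ k * (M * suc k ^ suc k)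
      survivors = survivor-bound K j Q P W W+KQ≡P X≤P (bracket⇒close a b a-large upper)
      NaWᵏ : (N * a * W) ^ k ≡ N ^ k * (Q * W ^ k)
      NaWᵏ = trans (^-distribʳ-* (N * a) W k) (trans (cong (_* W ^ k) (^-distribʳ-* N a k)) (*-assoc (N ^ k) Q (W ^ k)))

  deletion-weights : ∀ N → ∃[ a ] ∃[ d ] ∃[ L ] 1 ≤ a + d
    × L * (a + d) ^ suc k + N * K * a ^ suc k < (a + d) ^ suc k + N * a * (a + d) ^ k
    × k ^ k * N ^ k ≤ L ^ k * (M * suc k ^ suc k)
  deletion-weights N =
    let (a , b , 1≤b , a-large , lower , upper) = pow-bracket c j (suc (2 * M) * k) (s≤s z≤n) (s≤s z≤n)
        a+d≡b = m+[n∸m]≡n (^-cancelˡ-≤ k {a} {b} (≤-trans (m≤n*m (a ^ k) c) lower))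
        (L , gain , size) = weights-from-bracket N a (b ∸ a) (subst (1 ≤_) (sym a+d≡b) 1≤b) a-large
          (subst (λ b → c * a ^ k ≤ b ^ k) (sym a+d≡b) lower) (subst (λ b → b ^ k < c * suc a ^ k) (sym a+d≡b) upper)
    in a , b ∸ a , L , subst (1 ≤_) (sym a+d≡b) 1≤b , gain , size

^-*-<-eventually : ∀ P Q C → P < Q → ∀ n → suc (P * C) ≤ n → P ^ n * C < Q ^ n
^-*-<-eventually zero Q C P<Q (suc i) _ = m^n>0 Q {{>-nonZero P<Q}} (suc i)
^-*-<-eventually P@(suc _) Q C P<Q (suc i) PC<n = begin-strict
  P ^ suc i * C          ≡⟨ xy∙z≈y∙xz P (P ^ i) C ⟩
  P ^ i * (P * C)        <⟨ *-monoʳ-< (P ^ i) {{m^n≢0 P i}} (≤-trans PC<n (m≤n+m (suc i) P)) ⟩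
  P ^ i * (P + suc i)    ≡⟨ cong (λ z → P ^ i * (P + z)) (*-identityʳ (suc i)) ⟨
  P ^ i * (P + suc i * 1) ≤⟨ bernoulli P 1 i ⟩
  (P + 1) ^ suc i        ≤⟨ ^-monoˡ-≤ (suc i) (≤-trans (≤-reflexive (+-comm P 1)) P<Q) ⟩
  Q ^ suc i              ∎
  where open ≤-Reasoning

size-bound⇒rate : ∀ j m a b → 1 ≤ m → a ^ suc j < m ^ (suc j * suc j ∸ 1) * b ^ suc j →
  ∃[ N₀ ] ∀ n → N₀ ≤ n → ∀ s →
    suc j ^ suc j * m ^ (suc j * suc j * n) ≤ s ^ suc j * m ^ n * suc (suc j) ^ suc (suc j) →
    a ^ n < s * b ^ n
size-bound⇒rate j m a b 1≤m rate = suc (a ^ k * C) , beats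
  where
  k = suc j
  C = suc k ^ suc k
  e = k * k ∸ 1
  beats : ∀ n → suc (a ^ k * C) ≤ n → ∀ s → k ^ k * m ^ (k * k * n) ≤ s ^ k * m ^ n * C → a ^ n < s * b ^ n
  beats n n-large s size = ^-cancelˡ-< k (*-cancelʳ-< (m ^ n * C) _ _ (begin-strict
    (a ^ n) ^ k * (m ^ n * C)         ≡⟨ cong (_* (m ^ n * C)) (^-comm-^ a n k) ⟩
    (a ^ k) ^ n * (m ^ n * C)         ≡⟨ x∙yz≈y∙xz ((a ^ k) ^ n) (m ^ n) C ⟩
    m ^ n * ((a ^ k) ^ n * C)         <⟨ *-monoʳ-< (m ^ n) (^-*-<-eventually (a ^ k) (m ^ e * b ^ k) C rate n n-large) ⟩
    m ^ n * (m ^ e * b ^ k) ^ n       ≡⟨ cong (m ^ n *_) (^-distribʳ-* (m ^ e) (b ^ k) n) ⟩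
    m ^ n * ((m ^ e) ^ n * (b ^ k) ^ n) ≡⟨ cong₂ (λ x y → m ^ n * (x * y)) (^-*-assoc m e n) (^-comm-^ b k n) ⟩
    m ^ n * (m ^ (e * n) * bᵏⁿ)       ≡⟨ *-assoc (m ^ n) (m ^ (e * n)) bᵏⁿ ⟨
    m ^ n * m ^ (e * n) * bᵏⁿ         ≡⟨ cong (_* bᵏⁿ) (^-distribˡ-+-* m n (e * n)) ⟨
    m ^ (k * k * n) * bᵏⁿ             ≤⟨ *-monoˡ-≤ bᵏⁿ (m≤n*m (m ^ (k * k * n)) (k ^ k) {{m^n≢0 k k}}) ⟩
    k ^ k * m ^ (k * k * n) * bᵏⁿ     ≤⟨ *-monoˡ-≤ bᵏⁿ size ⟩
    s ^ k * m ^ n * C * bᵏⁿ           ≡⟨ ring (s ^ k) (m ^ n) C bᵏⁿ ⟩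
    s ^ k * bᵏⁿ * (m ^ n * C)         ≡⟨ cong (_* (m ^ n * C)) (^-distribʳ-* s (b ^ n) k) ⟨
    (s * b ^ n) ^ k * (m ^ n * C)     ∎))
    where
    open ≤-Reasoning
    instance
      mⁿ≢0 : NonZero (m ^ n)
      mⁿ≢0 = m^n≢0 m n {{>-nonZero 1≤m}}
    bᵏⁿ = (b ^ n) ^ k
    ring : ∀ x y z w → x * y * z * w ≡ x * w * (y * z)
    ring = solve-∀

-- Finite sums and indicators

∑ : {B : Set} → List B → (B → ℕ) → ℕ
∑ [] f = 0
∑ (y ∷ ys) f = f y + ∑ ys f

module _ {B : Set} where

  ∑-mono-≤ : ∀ (ys : List B) {f g : B → ℕ} → (∀ {y} → y ∈ ys → f y ≤ g y) → ∑ ys f ≤ ∑ ys g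
  ∑-mono-≤ [] f≤g = z≤n
  ∑-mono-≤ (y ∷ ys) f≤g = +-mono-≤ (f≤g (here refl)) (∑-mono-≤ ys (f≤g ∘ there))

  ∑-mono-< : ∀ (ys : List B) {f g : B → ℕ} → (∀ {y} → y ∈ ys → f y ≤ g y) →
    ∀ {y₀} → y₀ ∈ ys → f y₀ < g y₀ → ∑ ys f < ∑ ys g
  ∑-mono-< (y ∷ ys) f≤g (here refl) f<g = +-mono-<-≤ f<g (∑-mono-≤ ys (f≤g ∘ there))
  ∑-mono-< (y ∷ ys) f≤g (there y₀∈ys) f<g = +-mono-≤-< (f≤g (here refl)) (∑-mono-< ys (f≤g ∘ there) y₀∈ys f<g)

  ∑-const : ∀ (ys : List B) {f : B → ℕ} {v} → (∀ {y} → y ∈ ys → f y ≡ v) → ∑ ys f ≡ length ys * v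
  ∑-const [] f≡v = refl
  ∑-const (y ∷ ys) f≡v = cong₂ _+_ (f≡v (here refl)) (∑-const ys (f≡v ∘ there))

  ∑-*-distribˡ : ∀ (ys : List B) (f : B → ℕ) c → c * ∑ ys f ≡ ∑ ys (λ y → c * f y)
  ∑-*-distribˡ [] f c = *-zeroʳ c
  ∑-*-distribˡ (y ∷ ys) f c = trans (*-distribˡ-+ c (f y) (∑ ys f)) (cong (c * f y +_) (∑-*-distribˡ ys f c))

𝟙 : {P : Set} → Dec P → ℕ
𝟙 (yes _) = 1
𝟙 (no _) = 0

𝟙-mono : {P Q : Set} → (P → Q) → (p? : Dec P) (q? : Dec Q) → 𝟙 p? ≤ 𝟙 q?
𝟙-mono P⇒Q (yes p) (yes q) = ≤-refl
𝟙-mono P⇒Q (yes p) (no ¬q) = contradiction (P⇒Q p) ¬q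
𝟙-mono P⇒Q (no ¬p) q? = z≤n

𝟙-cong : {P Q : Set} → (P → Q) → (Q → P) → (p? : Dec P) (q? : Dec Q) → 𝟙 p? ≡ 𝟙 q?
𝟙-cong P⇒Q Q⇒P p? q? = ≤-antisym (𝟙-mono P⇒Q p? q?) (𝟙-mono Q⇒P q? p?)

𝟙-yes : {P : Set} → P → (p? : Dec P) → 𝟙 p? ≡ 1
𝟙-yes p (yes _) = refl
𝟙-yes p (no ¬p) = contradiction p ¬p

𝟙-no : {P : Set} → ¬ P → (p? : Dec P) → 𝟙 p? ≡ 0
𝟙-no ¬p (yes p) = contradiction p ¬p
𝟙-no ¬p (no _) = refl

-- Lists without repetitions

module _ {A : Set} where

  Unique-∷ : ∀ {x} {xs : List A} → x ∉ xs → Unique xs → Unique (x ∷ xs)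
  Unique-∷ {xs = xs} x∉xs xs! = All.tabulate (λ z∈xs x≡z → x∉xs (subst (_∈ xs) (sym x≡z) z∈xs)) ∷ xs!

  Unique-head : ∀ {x} {xs : List A} → Unique (x ∷ xs) → x ∉ xs
  Unique-head (x≢xs ∷ _) x∈xs = All.lookup x≢xs x∈xs refl

  Unique-tail : ∀ {x} {xs : List A} → Unique (x ∷ xs) → Unique xs
  Unique-tail (_ ∷ xs!) = xs!

module Removal {A : Set} (_≟_ : DecidableEquality A) where

  differs? : (x : A) → Decidable (x ≢_)
  differs? x y = ¬? (x ≟ y)

  remove : A → List A → List A
  remove x = filter (differs? x)

  ∈-remove⁻ : ∀ {x z} ys → z ∈ remove x ys → z ∈ ys × x ≢ z
  ∈-remove⁻ {x} ys = ∈-filter⁻ (differs? x)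

  ∈-remove⁺ : ∀ {x z ys} → z ∈ ys → x ≢ z → z ∈ remove x ys
  ∈-remove⁺ {x} = ∈-filter⁺ (differs? x)

  remove⁺ : ∀ {x ys} → Unique ys → Unique (remove x ys)
  remove⁺ {x} = filter⁺ (differs? x)

  remove-⊆ : ∀ {x} ys → remove x ys ⊆ ys
  remove-⊆ {x} = filter-⊆ (differs? x)

  length-remove : ∀ {x ys} → x ∈ ys → Unique ys → length ys ≡ suc (length (remove x ys))
  length-remove {x} {y ∷ ys} (here refl) (x≢ys ∷ _) = cong suc (begin
    length ys                     ≡⟨ cong length (filter-all (differs? x) x≢ys) ⟨
    length (remove x ys)          ≡⟨ cong length (filter-reject (differs? x) {x} (λ x≢x → x≢x refl)) ⟨
    length (remove x (x ∷ ys))    ∎)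
    where open ≡-Reasoning
  length-remove {x} {y ∷ ys} (there x∈ys) ys! = begin
    suc (length ys)                      ≡⟨ cong suc (length-remove x∈ys (Unique-tail ys!)) ⟩
    suc (suc (length (remove x ys)))     ≡⟨ cong (suc ∘ length) (filter-accept (differs? x) x≢y) ⟨
    suc (length (remove x (y ∷ ys)))     ∎
    where
    open ≡-Reasoning
    x≢y : x ≢ y
    x≢y x≡y = Unique-head ys! (subst (_∈ ys) x≡y x∈ys)

  ⊆-∷⇒remove-⊆ : ∀ {x D T} → D ⊆ x ∷ T → remove x D ⊆ T
  ⊆-∷⇒remove-⊆ {D = D} D⊆x∷T z∈D⁻ with ∈-remove⁻ D z∈D⁻
  ... | z∈D , x≢z with D⊆x∷T z∈D
  ...   | here z≡x = contradiction (sym z≡x) x≢z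
  ...   | there z∈T = z∈T

  remove-⊆⇒⊆-∷ : ∀ {x D T} → remove x D ⊆ T → D ⊆ x ∷ T
  remove-⊆⇒⊆-∷ {x} D⁻⊆T {z} z∈D with x ≟ z
  ... | yes refl = here refl
  ... | no x≢z = there (D⁻⊆T (∈-remove⁺ z∈D x≢z))

-- The deletion method, derandomised

-- weightedSum U f = ∑_{T ⊆ U} a^|T| d^(|U| - |T|) f T over the sublists T of U, that is
-- (a + d)^|U| times the expectation of f on the random sublist keeping each element
-- independently with probability a / (a + d).
module WeightedSums {A : Set} (_≟_ : DecidableEquality A) (a d : ℕ) where
  open Removal _≟_
  open import Data.List.Relation.Binary.Subset.DecPropositional _≟_ using (_⊆?_)
  open import Data.List.Membership.DecPropositional _≟_ using (_∈?_)

  b : ℕ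
  b = a + d

  weightedSum : List A → (List A → ℕ) → ℕ
  weightedSum [] f = f []
  weightedSum (x ∷ U) f = a * weightedSum U (f ∘ (x ∷_)) + d * weightedSum U f

  weightedSum-cong : ∀ U {f g : List A → ℕ} → (∀ T → T ⊆ U → f T ≡ g T) → weightedSum U f ≡ weightedSum U g
  weightedSum-cong [] f≡g = f≡g [] (λ ())
  weightedSum-cong (x ∷ U) f≡g = cong₂ (λ p q → a * p + d * q)
    (weightedSum-cong U (λ T T⊆U → f≡g (x ∷ T) (∷⁺ʳ x T⊆U)))
    (weightedSum-cong U (λ T T⊆U → f≡g T (⊆-trans T⊆U (xs⊆x∷xs U x))))

  weightedSum-+ : ∀ U (f g : List A → ℕ) → weightedSum U (λ T → f T + g T) ≡ weightedSum U f + weightedSum U g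
  weightedSum-+ [] f g = refl
  weightedSum-+ (x ∷ U) f g = trans
    (cong₂ (λ p q → a * p + d * q) (weightedSum-+ U (f ∘ (x ∷_)) (g ∘ (x ∷_))) (weightedSum-+ U f g))
    (ring a d _ _ _ _)
    where
    ring : ∀ a d p q r s → a * (p + q) + d * (r + s) ≡ (a * p + d * r) + (a * q + d * s)
    ring = solve-∀

  weightedSum-const : ∀ U c → weightedSum U (λ _ → c) ≡ b ^ length U * c
  weightedSum-const [] c = sym (+-identityʳ c)
  weightedSum-const (x ∷ U) c = trans
    (cong₂ (λ p q → a * p + d * q) (weightedSum-const U c) (weightedSum-const U c))
    (ring a d (b ^ length U) c)
    where
    ring : ∀ a d p c → a * (p * c) + d * (p * c) ≡ (a + d) * p * c
    ring = solve-∀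

  weightedSum-length : ∀ U → b * weightedSum U length ≡ length U * a * b ^ length U
  weightedSum-length [] = *-zeroʳ b
  weightedSum-length (x ∷ U) = begin
    b * (a * weightedSum U (suc ∘ length) + d * S)    ≡⟨ cong (λ z → b * (a * z + d * S)) (weightedSum-+ U (λ _ → 1) length) ⟩
    b * (a * (weightedSum U (λ _ → 1) + S) + d * S)   ≡⟨ cong (λ z → b * (a * (z + S) + d * S)) (weightedSum-const U 1) ⟩
    (a + d) * (a * (B * 1 + S) + d * S)               ≡⟨ ring₁ a d B S ⟩
    a * ((a + d) * B) + (a + d) * ((a + d) * S)       ≡⟨ cong (λ z → a * ((a + d) * B) + (a + d) * z) (weightedSum-length U) ⟩
    a * ((a + d) * B) + (a + d) * (length U * a * B)  ≡⟨ ring₂ a d B (length U) ⟩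
    suc (length U) * a * ((a + d) * B)                ∎
    where
    open ≡-Reasoning
    B = b ^ length U
    S = weightedSum U length
    ring₁ : ∀ a d B S → (a + d) * (a * (B * 1 + S) + d * S) ≡ a * ((a + d) * B) + (a + d) * ((a + d) * S)
    ring₁ = solve-∀
    ring₂ : ∀ a d B n → a * ((a + d) * B) + (a + d) * (n * a * B) ≡ (1 + n) * a * ((a + d) * B)
    ring₂ = solve-∀

  weightedSum-∑ : ∀ U {I : Set} (is : List I) (h : I → List A → ℕ) →
    weightedSum U (λ T → ∑ is (λ i → h i T)) ≡ ∑ is (λ i → weightedSum U (h i))
  weightedSum-∑ U [] h = trans (weightedSum-const U 0) (*-zeroʳ (b ^ length U))
  weightedSum-∑ U (i ∷ is) h = trans (weightedSum-+ U (h i) (λ T → ∑ is (λ i → h i T)))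
    (cong (weightedSum U (h i) +_) (weightedSum-∑ U is h))

  -- A fixed D ⊆ U lies inside the random sublist with probability (a / (a + d))^|D|.
  weightedSum-⊇ : ∀ U D → Unique U → Unique D → D ⊆ U →
    b ^ length D * weightedSum U (λ T → 𝟙 (D ⊆? T)) ≡ a ^ length D * b ^ length U
  weightedSum-⊇ [] [] _ _ _ = refl
  weightedSum-⊇ [] (y ∷ D) _ _ D⊆[] with D⊆[] (here refl)
  ... | ()
  weightedSum-⊇ (x ∷ U) D U! D! D⊆x∷U with x ∈? D
  ... | yes x∈D = begin
    b ^ length D * (a * weightedSum U (λ T → 𝟙 (D ⊆? x ∷ T)) + d * weightedSum U (λ T → 𝟙 (D ⊆? T)))
      ≡⟨ cong₂ (λ p q → b ^ length D * (a * p + d * q)) without-x vanishes ⟩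
    b ^ length D * (a * S + d * 0)          ≡⟨ cong (λ n → b ^ n * (a * S + d * 0)) |D|≡ ⟩
    b * b ^ length D⁻ * (a * S + d * 0)     ≡⟨ ring₁ a d b (b ^ length D⁻) S ⟩
    a * (b * (b ^ length D⁻ * S))           ≡⟨ cong (λ z → a * (b * z)) (weightedSum-⊇ U D⁻ (Unique-tail U!) (remove⁺ D!) D⁻⊆U) ⟩
    a * (b * (a ^ length D⁻ * b ^ length U)) ≡⟨ ring₂ a b (a ^ length D⁻) (b ^ length U) ⟩
    a * a ^ length D⁻ * (b * b ^ length U)  ≡⟨ cong (λ n → a ^ n * b ^ length (x ∷ U)) |D|≡ ⟨
    a ^ length D * b ^ length (x ∷ U)       ∎
    where
    open ≡-Reasoning
    D⁻ = remove x D
    S = weightedSum U (λ T → 𝟙 (D⁻ ⊆? T))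
    |D|≡ : length D ≡ suc (length D⁻)
    |D|≡ = length-remove x∈D D!
    D⁻⊆U : D⁻ ⊆ U
    D⁻⊆U = ⊆-∷⇒remove-⊆ D⊆x∷U
    without-x : weightedSum U (λ T → 𝟙 (D ⊆? x ∷ T)) ≡ S
    without-x = weightedSum-cong U (λ T _ → 𝟙-cong ⊆-∷⇒remove-⊆ remove-⊆⇒⊆-∷ _ _)
    vanishes : weightedSum U (λ T → 𝟙 (D ⊆? T)) ≡ 0
    vanishes = begin
      weightedSum U (λ T → 𝟙 (D ⊆? T)) ≡⟨ weightedSum-cong U (λ T T⊆U → 𝟙-no (λ D⊆T → Unique-head U! (T⊆U (D⊆T x∈D))) _) ⟩
      weightedSum U (λ _ → 0)          ≡⟨ weightedSum-const U 0 ⟩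
      b ^ length U * 0                 ≡⟨ *-zeroʳ (b ^ length U) ⟩
      0                                ∎
    ring₁ : ∀ a d b B S → b * B * (a * S + d * 0) ≡ a * (b * (B * S))
    ring₁ = solve-∀
    ring₂ : ∀ a b A B → a * (b * (A * B)) ≡ a * A * (b * B)
    ring₂ = solve-∀
  ... | no x∉D = begin
    b ^ length D * (a * weightedSum U (λ T → 𝟙 (D ⊆? x ∷ T)) + d * S)
      ≡⟨ cong (λ p → b ^ length D * (a * p + d * S)) without-x ⟩
    b ^ length D * (a * S + d * S)         ≡⟨ ring a d (b ^ length D) S ⟩
    b * (b ^ length D * S)                 ≡⟨ cong (b *_) (weightedSum-⊇ U D (Unique-tail U!) D! (⊆∷∧∉⇒⊆ D⊆x∷U x∉D)) ⟩
    b * (a ^ length D * b ^ length U)      ≡⟨ x∙yz≈y∙xz b (a ^ length D) (b ^ length U) ⟩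
    a ^ length D * b ^ length (x ∷ U)      ∎
    where
    open ≡-Reasoning
    S = weightedSum U (λ T → 𝟙 (D ⊆? T))
    without-x : weightedSum U (λ T → 𝟙 (D ⊆? x ∷ T)) ≡ S
    without-x = weightedSum-cong U (λ T _ → 𝟙-cong (dropped {T}) added _ _)
      where
      dropped : ∀ {T} → D ⊆ x ∷ T → D ⊆ T
      dropped D⊆x∷T = ⊆∷∧∉⇒⊆ D⊆x∷T x∉D
      added : ∀ {T} → D ⊆ T → D ⊆ x ∷ T
      added {T} D⊆T = ⊆-trans D⊆T (xs⊆x∷xs T x)
    ring : ∀ a d B S → B * (a * S + d * S) ≡ (a + d) * (B * S)
    ring = solve-∀

  weightedSum-<⇒∃ : ∀ U {f g : List A → ℕ} → Unique U → weightedSum U f < weightedSum U g →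
    ∃[ T ] T ⊆ U × Unique T × f T < g T
  weightedSum-<⇒∃ [] _ f<g = [] , (λ ()) , [] , f<g
  weightedSum-<⇒∃ (x ∷ U) {f} {g} U! f<g with weightedSum U (f ∘ (x ∷_)) <? weightedSum U (g ∘ (x ∷_))
  ... | yes with-x =
    let (T , T⊆U , T! , fT<gT) = weightedSum-<⇒∃ U (Unique-tail U!) with-x
    in x ∷ T , ∷⁺ʳ x T⊆U , Unique-∷ (λ x∈T → Unique-head U! (T⊆U x∈T)) T! , fT<gT
  ... | no ¬with-x with weightedSum U f <? weightedSum U g
  ...   | yes without-x =
    let (T , T⊆U , T! , fT<gT) = weightedSum-<⇒∃ U (Unique-tail U!) without-x
    in T , ⊆-trans T⊆U (xs⊆x∷xs U x) , T! , fT<gT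
  ...   | no ¬without-x = contradiction f<g
    (≤⇒≯ (+-mono-≤ (*-monoʳ-≤ a (≮⇒≥ ¬with-x)) (*-monoʳ-≤ d (≮⇒≥ ¬without-x))))

module Deletion {A : Set} (_≟_ : DecidableEquality A) {I : Set} (configs : List I)
                (members : I → List A) (anchor : I → A) (anchor∈ : ∀ i → anchor i ∈ members i) where
  open Removal _≟_
  open import Data.List.Relation.Binary.Subset.DecPropositional _≟_ using (_⊆?_)

  occurrences : List A → ℕ
  occurrences T = ∑ configs (λ i → 𝟙 (members i ⊆? T))

  Avoids : List A → Set
  Avoids S = ∀ {i} → i ∈ configs → ¬ (members i ⊆ S)

  delete-occurrences : ∀ T → Unique T → ∃[ S ] Unique S × Avoids S × length T ≤ length S + occurrences T
  delete-occurrences T = go T (<-wellFounded (occurrences T))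
    where
    go : ∀ T → Acc _<_ (occurrences T) → Unique T → ∃[ S ] Unique S × Avoids S × length T ≤ length S + occurrences T
    go T (acc smaller) T! with any? (λ i → members i ⊆? T) configs
    ... | no none = T , T! , (λ i∈ Mi⊆T → none (lose i∈ Mi⊆T)) , m≤m+n (length T) _
    ... | yes some with find some
    ...   | i , i∈ , Mi⊆T =
      let (S , S! , avoids , |T⁻|≤) = go T⁻ (smaller fewer) (remove⁺ T!)
      in S , S! , avoids , (begin
        length T                        ≡⟨ length-remove (Mi⊆T (anchor∈ i)) T! ⟩
        suc (length T⁻)                 ≤⟨ s≤s |T⁻|≤ ⟩
        suc (length S + occurrences T⁻) ≡⟨ +-suc (length S) (occurrences T⁻) ⟨
        length S + suc (occurrences T⁻) ≤⟨ +-monoʳ-≤ (length S) fewer ⟩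
        length S + occurrences T        ∎)
      where
      open ≤-Reasoning
      T⁻ = remove (anchor i) T
      fewer : occurrences T⁻ < occurrences T
      fewer = ∑-mono-< configs (λ {j} _ → 𝟙-mono (shrunk {j}) _ _) i∈
        (subst₂ _<_ (sym (𝟙-no broken _)) (sym (𝟙-yes {members i ⊆ T} Mi⊆T _)) (s≤s z≤n))
        where
        shrunk : ∀ {j} → members j ⊆ T⁻ → members j ⊆ T
        shrunk Mj⊆T⁻ = ⊆-trans Mj⊆T⁻ (remove-⊆ T)
        broken : ¬ (members i ⊆ T⁻)
        broken Mi⊆T⁻ = proj₂ (∈-remove⁻ T (Mi⊆T⁻ (anchor∈ i))) refl

-- Enumerations

length-cartesianProductWith : ∀ {X Y Z : Set} (f : X → Y → Z) xs ys →
  length (cartesianProductWith f xs ys) ≡ length xs * length ys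
length-cartesianProductWith f [] ys = refl
length-cartesianProductWith f (x ∷ xs) ys = trans (length-++ (map (f x) ys))
  (cong₂ _+_ (length-map (f x) ys) (length-cartesianProductWith f xs ys))

vectors : {B : Set} → List B → (j : ℕ) → List (Vec B j)
vectors xs zero = [] ∷ []
vectors xs (suc j) = cartesianProductWith _∷_ xs (vectors xs j)

module _ {B : Set} (xs : List B) where

  length-vectors : ∀ j → length (vectors xs j) ≡ length xs ^ j
  length-vectors zero = refl
  length-vectors (suc j) = trans (length-cartesianProductWith _∷_ xs (vectors xs j)) (cong (length xs *_) (length-vectors j))

  ∈-vectors : (∀ x → x ∈ xs) → ∀ {j} (v : Vec B j) → v ∈ vectors xs j
  ∈-vectors complete [] = here refl
  ∈-vectors complete (x ∷ v) = ∈-cartesianProductWith⁺ _∷_ (complete x) (∈-vectors complete v)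

  vectors⁺ : Unique xs → ∀ j → Unique (vectors xs j)
  vectors⁺ xs! zero = [] ∷ []
  vectors⁺ xs! (suc j) = cartesianProductWith⁺ _∷_ Vecₚ.∷-injective xs! (vectors⁺ xs! j)

-- Corners in G^n

module Corners {m : ℕ} (G : FinAbGroup m) where
  open FinAbGroup G
  open IsAbelianGroup isAbelianGroup using (identityʳ; isGroup)

  group : Group 0ℓ 0ℓ
  group = record { isGroup = isGroup }
  open GroupProperties group using (identityʳ-unique)

  ⊕ⁿ-identityʳ : ∀ {n} (v : Vec (Fin m) n) → _⊕ⁿ_ G v (0ⁿ G n) ≡ v
  ⊕ⁿ-identityʳ = Vecₚ.zipWith-identityʳ identityʳ

  ⊕ⁿ-identityʳ-unique : ∀ {n} (v l : Vec (Fin m) n) → _⊕ⁿ_ G v l ≡ v → l ≡ 0ⁿ G n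
  ⊕ⁿ-identityʳ-unique [] [] _ = refl
  ⊕ⁿ-identityʳ-unique (y ∷ v) (z ∷ l) eq =
    cong₂ _∷_ (identityʳ-unique y z (Vecₚ.∷-injectiveˡ eq)) (⊕ⁿ-identityʳ-unique v l (Vecₚ.∷-injectiveʳ eq))

  shift-fixed⇒0 : ∀ {n k} (x : Vec (Vec (Fin m) n) k) i l → shift (_⊕ⁿ_ G) x i l ≡ x → l ≡ 0ⁿ G n
  shift-fixed⇒0 x i l xᵢ≡x = ⊕ⁿ-identityʳ-unique (Vec.lookup x i) l
    (trans (sym (Vecₚ.lookup∘updateAt i x)) (cong (λ v → Vec.lookup v i) xᵢ≡x))

  -- Only the (i+1)-st point of a corner has x_i + λ as its i-th coordinate.
  cornerTuple-injective : ∀ {n k} (x : Vec (Vec (Fin m) n) k) l → l ≢ 0ⁿ G n →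
    Injective _≡_ _≡_ (cornerTuple (_⊕ⁿ_ G) x l)
  cornerTuple-injective x l l≢0 {zero} {zero} _ = refl
  cornerTuple-injective x l l≢0 {zero} {suc i} x≡xᵢ = contradiction (shift-fixed⇒0 x i l (sym x≡xᵢ)) l≢0
  cornerTuple-injective x l l≢0 {suc i} {zero} xᵢ≡x = contradiction (shift-fixed⇒0 x i l xᵢ≡x) l≢0
  cornerTuple-injective x l l≢0 {suc i} {suc j} xᵢ≡xⱼ with i Fin.≟ j
  ... | yes i≡j = cong suc i≡j
  ... | no i≢j = contradiction (⊕ⁿ-identityʳ-unique (Vec.lookup x i) l (begin
    _⊕ⁿ_ G (Vec.lookup x i) l                  ≡⟨ Vecₚ.lookup∘updateAt i x ⟨
    Vec.lookup (shift (_⊕ⁿ_ G) x i l) i        ≡⟨ cong (λ v → Vec.lookup v i) xᵢ≡xⱼ ⟩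
    Vec.lookup (shift (_⊕ⁿ_ G) x j l) i        ≡⟨ Vecₚ.lookup∘updateAt′ i j i≢j x ⟩
    Vec.lookup x i                             ∎)) l≢0
    where open ≡-Reasoning

-- Large corner-free sets

module CornerFreeSets {m : ℕ} (G : FinAbGroup m) (n j : ℕ) where
  open Corners G using (cornerTuple-injective)
  k : ℕ
  k = suc j
  Element Point : Set
  Element = Vec (Fin m) n
  Point = Vec Element k

  _≟ᴱ_ : DecidableEquality Element
  _≟ᴱ_ = Vecₚ.≡-dec Fin._≟_
  _≟ᴾ_ : DecidableEquality Point
  _≟ᴾ_ = Vecₚ.≡-dec _≟ᴱ_
  open Removal _≟ᴱ_ using (remove; ∈-remove⁻; ∈-remove⁺; length-remove)

  elements : List Element
  elements = vectors (allFin m) n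
  points : List Point
  points = vectors elements k
  nonzero : List Element
  nonzero = remove (0ⁿ G n) elements
  corners : List (Point × Element)
  corners = cartesianProduct points nonzero
  cornerPoints : Point × Element → List Point
  cornerPoints (x , l) = tabulate (cornerTuple (_⊕ⁿ_ G) x l)

  ∈-elements : ∀ v → v ∈ elements
  ∈-elements = ∈-vectors (allFin m) ∈-allFin
  ∈-points : ∀ x → x ∈ points
  ∈-points = ∈-vectors elements ∈-elements
  elements! : Unique elements
  elements! = vectors⁺ (allFin m) (allFin⁺ m) n
  points! : Unique points
  points! = vectors⁺ elements elements! k

  K N : ℕ
  K = length nonzero
  N = length points

  |elements|≡ : length elements ≡ m ^ n
  |elements|≡ = trans (length-vectors (allFin m) n) (cong (_^ n) (length-tabulate (λ i → i)))
  suc-K≡ : suc K ≡ m ^ n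
  suc-K≡ = trans (sym (length-remove (∈-elements (0ⁿ G n)) elements!)) |elements|≡
  N≡ : N ≡ (m ^ n) ^ k
  N≡ = trans (length-vectors elements k) (cong (_^ k) |elements|≡)
  |corners|≡ : length corners ≡ N * K
  |corners|≡ = length-cartesianProductWith _,_ points nonzero

  cornerPoints! : ∀ {c} → c ∈ corners → Unique (cornerPoints c)
  cornerPoints! {x , l} c∈ = tabulate⁺ (cornerTuple-injective x l l≢0)
    where
    l≢0 : l ≢ 0ⁿ G n
    l≢0 l≡0 = proj₂ (∈-remove⁻ elements (proj₂ (∈-cartesianProduct⁻ points nonzero c∈))) (sym l≡0)

  open Deletion _≟ᴾ_ corners cornerPoints proj₁ (λ _ → here refl)

  avoids⇒cornerFree : ∀ {S} → Avoids S → CornerFree (_⊕ⁿ_ G) (0ⁿ G n) k S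
  avoids⇒cornerFree {S} avoids (x , l , l≢0 , all∈) = avoids
    (∈-cartesianProduct⁺ (∈-points x) (∈-remove⁺ (∈-elements l) (λ 0≡l → l≢0 (sym 0≡l))))
    corner⊆S
    where
    corner⊆S : cornerPoints (x , l) ⊆ S
    corner⊆S z∈ = let (i , z≡) = ∈-tabulate⁻ {f = cornerTuple (_⊕ⁿ_ G) x l} z∈ in subst (_∈ S) (sym z≡) (all∈ i)

  module Expectations (a d : ℕ) where
    open WeightedSums _≟ᴾ_ a d
    open import Data.List.Relation.Binary.Subset.DecPropositional _≟ᴾ_ using (_⊆?_)

    expected-size : b ^ suc k * weightedSum points (suc ∘ length) ≡ b ^ N * (b ^ suc k + N * a * b ^ k)
    expected-size = begin
      b ^ suc k * weightedSum points (suc ∘ length)               ≡⟨ cong (b ^ suc k *_) (weightedSum-+ points (λ _ → 1) length) ⟩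
      b ^ suc k * (weightedSum points (λ _ → 1) + weightedSum points length)
                                                                  ≡⟨ cong (λ z → b ^ suc k * (z + weightedSum points length)) (weightedSum-const points 1) ⟩
      b * b ^ k * (b ^ N * 1 + weightedSum points length)         ≡⟨ ring₁ b (b ^ k) (b ^ N) (weightedSum points length) ⟩
      b * b ^ k * b ^ N + b ^ k * (b * weightedSum points length) ≡⟨ cong (λ z → b * b ^ k * b ^ N + b ^ k * z) (weightedSum-length points) ⟩
      b * b ^ k * b ^ N + b ^ k * (N * a * b ^ N)                 ≡⟨ ring₂ (b * b ^ k) (b ^ k) (b ^ N) (N * a) ⟩
      b ^ N * (b ^ suc k + N * a * b ^ k)                         ∎
      where
      open ≡-Reasoning
      ring₁ : ∀ b bk bN S → b * bk * (bN * 1 + S) ≡ b * bk * bN + bk * (b * S)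
      ring₁ = solve-∀
      ring₂ : ∀ B bk bN Na → B * bN + bk * (Na * bN) ≡ bN * (B + Na * bk)
      ring₂ = solve-∀

    expected-occurrences : b ^ suc k * weightedSum points occurrences ≡ N * K * (a ^ suc k * b ^ N)
    expected-occurrences = begin
      b ^ suc k * weightedSum points occurrences                        ≡⟨ cong (b ^ suc k *_) (weightedSum-∑ points corners _) ⟩
      b ^ suc k * ∑ corners (λ c → weightedSum points (λ T → 𝟙 (cornerPoints c ⊆? T)))
                                                                        ≡⟨ ∑-*-distribˡ corners _ (b ^ suc k) ⟩
      ∑ corners (λ c → b ^ suc k * weightedSum points (λ T → 𝟙 (cornerPoints c ⊆? T)))
                                                                        ≡⟨ ∑-const corners each ⟩
      length corners * (a ^ suc k * b ^ N)                              ≡⟨ cong (_* (a ^ suc k * b ^ N)) |corners|≡ ⟩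
      N * K * (a ^ suc k * b ^ N)                                       ∎
      where
      open ≡-Reasoning
      each : ∀ {c} → c ∈ corners → b ^ suc k * weightedSum points (λ T → 𝟙 (cornerPoints c ⊆? T)) ≡ a ^ suc k * b ^ N
      each {c@(x , l)} c∈ = subst (λ z → b ^ z * weightedSum points (λ T → 𝟙 (cornerPoints c ⊆? T)) ≡ a ^ z * b ^ N)
        (length-tabulate (cornerTuple (_⊕ⁿ_ G) x l))
        (weightedSum-⊇ points (cornerPoints c) points! (cornerPoints! c∈) (λ {y} _ → ∈-points y))

    expected-gain : ∀ L → b ^ suc k * weightedSum points (λ T → L + occurrences T) ≡ b ^ N * (L * b ^ suc k + N * K * a ^ suc k)
    expected-gain L = begin
      b ^ suc k * weightedSum points (λ T → L + occurrences T)     ≡⟨ cong (b ^ suc k *_) (weightedSum-+ points (λ _ → L) occurrences) ⟩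
      b ^ suc k * (weightedSum points (λ _ → L) + weightedSum points occurrences)
                                                                   ≡⟨ *-distribˡ-+ (b ^ suc k) _ _ ⟩
      b ^ suc k * weightedSum points (λ _ → L) + b ^ suc k * weightedSum points occurrences
                                                                   ≡⟨ cong₂ _+_ (cong (b ^ suc k *_) (weightedSum-const points L)) expected-occurrences ⟩
      b ^ suc k * (b ^ N * L) + N * K * (a ^ suc k * b ^ N)        ≡⟨ ring (b ^ suc k) (b ^ N) L (N * K) (a ^ suc k) ⟩
      b ^ N * (L * b ^ suc k + N * K * a ^ suc k)                  ∎
      where
      open ≡-Reasoning
      ring : ∀ B bN L NK A → B * (bN * L) + NK * (A * bN) ≡ bN * (L * B + NK * A)
      ring = solve-∀

    corner-free-of-size : ∀ L → 1 ≤ b → L * b ^ suc k + N * K * a ^ suc k < b ^ suc k + N * a * b ^ k →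
      ∃[ S ] Unique S × CornerFree (_⊕ⁿ_ G) (0ⁿ G n) k S × L ≤ length S
    corner-free-of-size L 1≤b gain =
      let (T , _ , T! , L+occ<1+|T|) = weightedSum-<⇒∃ points points! expectations
          (S , S! , avoids , |T|≤) = delete-occurrences T T!
      in S , S! , avoids⇒cornerFree avoids , +-cancelʳ-≤ (occurrences T) L (length S) (≤-trans (≤-pred L+occ<1+|T|) |T|≤)
      where
      expectations : weightedSum points (λ T → L + occurrences T) < weightedSum points (suc ∘ length)
      expectations = *-cancelˡ-< (b ^ suc k) _ _ (subst₂ _<_ (sym (expected-gain L)) (sym expected-size)
        (*-monoʳ-< (b ^ N) {{m^n≢0 b N {{>-nonZero 1≤b}}}} gain))

  large-corner-free-set : ∃[ S ] Unique S × CornerFree (_⊕ⁿ_ G) (0ⁿ G n) k S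
    × k ^ k * m ^ (k * k * n) ≤ length S ^ k * m ^ n * suc k ^ suc k
  large-corner-free-set =
    let (a , d , L , 1≤b , gain , size) = DeletionWeights.deletion-weights K j N
        (S , S! , cornerFree , L≤|S|) = Expectations.corner-free-of-size a d L 1≤b gain
    in S , S! , cornerFree , (begin
      k ^ k * m ^ (k * k * n)              ≡⟨ cong (k ^ k *_) mᵏᵏⁿ≡Nᵏ ⟩
      k ^ k * N ^ k                        ≤⟨ size ⟩
      L ^ k * (suc K * suc k ^ suc k)      ≤⟨ *-monoˡ-≤ _ (^-monoˡ-≤ k L≤|S|) ⟩
      length S ^ k * (suc K * suc k ^ suc k) ≡⟨ cong (λ z → length S ^ k * (z * suc k ^ suc k)) suc-K≡ ⟩
      length S ^ k * (m ^ n * suc k ^ suc k) ≡⟨ *-assoc (length S ^ k) (m ^ n) (suc k ^ suc k) ⟨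
      length S ^ k * m ^ n * suc k ^ suc k ∎)
    where
    open ≤-Reasoning
    mᵏᵏⁿ≡Nᵏ : m ^ (k * k * n) ≡ N ^ k
    mᵏᵏⁿ≡Nᵏ = begin-equality
      m ^ (k * k * n)   ≡⟨ cong (m ^_) (ring k n) ⟩
      m ^ (n * k * k)   ≡⟨ ^-*-assoc m (n * k) k ⟨
      (m ^ (n * k)) ^ k ≡⟨ cong (_^ k) (^-*-assoc m n k) ⟨
      ((m ^ n) ^ k) ^ k ≡⟨ cong (_^ k) N≡ ⟨
      N ^ k             ∎
      where
      ring : ∀ k n → k * k * n ≡ n * k * k
      ring = solve-∀

-- Strong powers of the corner hypergraph

module _ {A : Set} where

  zipWith-∷-head-tail : ∀ {n j} (x : Vec (Vec A (suc n)) j) → Vec.zipWith _∷_ (Vec.map Vec.head x) (Vec.map Vec.tail x) ≡ x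
  zipWith-∷-head-tail [] = refl
  zipWith-∷-head-tail ((y ∷ ys) ∷ x) = cong ((y ∷ ys) ∷_) (zipWith-∷-head-tail x)

  map-tail-zipWith-∷ : ∀ {n j} (h : Vec A j) (w : Vec (Vec A n) j) → Vec.map Vec.tail (Vec.zipWith _∷_ h w) ≡ w
  map-tail-zipWith-∷ [] [] = refl
  map-tail-zipWith-∷ (y ∷ h) (v ∷ w) = cong (v ∷_) (map-tail-zipWith-∷ h w)

  map-head-zipWith-∷ : ∀ {n j} (h : Vec A j) (w : Vec (Vec A n) j) → Vec.map Vec.head (Vec.zipWith _∷_ h w) ≡ h
  map-head-zipWith-∷ [] [] = refl
  map-head-zipWith-∷ (y ∷ h) (v ∷ w) = cong (y ∷_) (map-head-zipWith-∷ h w)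

  replicate-[] : ∀ {j} (x : Vec (Vec A 0) j) → Vec.replicate j [] ≡ x
  replicate-[] [] = refl
  replicate-[] ([] ∷ x) = cong ([] ∷_) (replicate-[] x)

  cornerTuple-identity : (_+_ : A → A → A) {e : A} → (∀ a → a + e ≡ a) → ∀ {k} (x : Vec A k) i → cornerTuple _+_ x e i ≡ x
  cornerTuple-identity _+_ identityʳ x zero = refl
  cornerTuple-identity _+_ identityʳ x (suc i) = Vecₚ.updateAt-id-local i x (identityʳ (Vec.lookup x i))

module StrongPowers {m : ℕ} (G : FinAbGroup m) (k : ℕ) where
  open FinAbGroup G
  open IsAbelianGroup isAbelianGroup using (identityʳ)
  open Corners G using (⊕ⁿ-identityʳ)

  H : Hypergraph (suc k)
  H = Hcor G k

  Points : ℕ → Set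
  Points n = Vec (Vec (Fin m) n) k

  -- The last factor of H^⊠(n+1) records the first coordinate of every component.
  toPower : ∀ n → Points n → V (H ^⊠ n)
  toPower zero _ = tt
  toPower (suc n) x = toPower n (Vec.map Vec.tail x) , Vec.map Vec.head x

  fromPower : ∀ n → V (H ^⊠ n) → Points n
  fromPower zero _ = Vec.replicate k []
  fromPower (suc n) (v , h) = Vec.zipWith _∷_ h (fromPower n v)

  fromPower∘toPower : ∀ n x → fromPower n (toPower n x) ≡ x
  fromPower∘toPower zero x = replicate-[] x
  fromPower∘toPower (suc n) x = trans
    (cong (Vec.zipWith _∷_ (Vec.map Vec.head x)) (fromPower∘toPower n (Vec.map Vec.tail x)))
    (zipWith-∷-head-tail x)

  toPower∘fromPower : ∀ n v → toPower n (fromPower n v) ≡ v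
  toPower∘fromPower zero v = refl
  toPower∘fromPower (suc n) (v , h) = cong₂ _,_
    (trans (cong (toPower n) (map-tail-zipWith-∷ h (fromPower n v))) (toPower∘fromPower n v))
    (map-head-zipWith-∷ h (fromPower n v))

  toPower-injective : ∀ n → Injective _≡_ _≡_ (toPower n)
  toPower-injective n {x} {y} eq = trans (sym (fromPower∘toPower n x)) (trans (cong (fromPower n) eq) (fromPower∘toPower n y))

  corner : ∀ {n} → Points n → Vec (Fin m) n → Fin (suc k) → Points n
  corner = cornerTuple (_⊕ⁿ_ G)

  tail-corner : ∀ {n} (x : Points (suc n)) l₀ l i →
    Vec.map Vec.tail (corner x (l₀ ∷ l) i) ≡ corner (Vec.map Vec.tail x) l i
  tail-corner x l₀ l zero = refl
  tail-corner x l₀ l (suc i) = Vecₚ.map-updateAt x i (tail-⊕ⁿ (Vec.lookup x i))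
    where
    tail-⊕ⁿ : ∀ v → Vec.tail (_⊕ⁿ_ G v (l₀ ∷ l)) ≡ _⊕ⁿ_ G (Vec.tail v) l
    tail-⊕ⁿ (_ ∷ _) = refl

  head-corner : ∀ {n} (x : Points (suc n)) l₀ l i →
    Vec.map Vec.head (corner x (l₀ ∷ l) i) ≡ cornerTuple _∙_ (Vec.map Vec.head x) l₀ i
  head-corner x l₀ l zero = refl
  head-corner x l₀ l (suc i) = Vecₚ.map-updateAt x i (head-⊕ⁿ (Vec.lookup x i))
    where
    head-⊕ⁿ : ∀ v → Vec.head (_⊕ⁿ_ G v (l₀ ∷ l)) ≡ Vec.head v ∙ l₀
    head-⊕ⁿ (_ ∷ _) = refl

  CornerImage : ∀ n → (Fin (suc k) → V (H ^⊠ n)) → Vec (Fin m) n → Set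
  CornerImage n e l = ∃[ x ] ∀ i → e i ≡ toPower n (corner x l i)

  allEqual⇒trivial : ∀ n e → AllEqual e → CornerImage n e (0ⁿ G n)
  allEqual⇒trivial n e same = fromPower n (e zero) , λ i → begin
    e i                                           ≡⟨ same i zero ⟩
    e zero                                        ≡⟨ toPower∘fromPower n (e zero) ⟨
    toPower n (fromPower n (e zero))              ≡⟨ cong (toPower n) (cornerTuple-identity (_⊕ⁿ_ G) ⊕ⁿ-identityʳ _ i) ⟨
    toPower n (corner (fromPower n (e zero)) (0ⁿ G n) i) ∎
    where open ≡-Reasoning

  extend : ∀ n e l → CornerImage n (proj₁ ∘ e) l → ∀ x₀ l₀ → (∀ i → proj₂ (e i) ≡ cornerTuple _∙_ x₀ l₀ i) →
    CornerImage (suc n) e (l₀ ∷ l)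
  extend n e l (x , eˡ) x₀ l₀ e₀ = X , λ i → cong₂ _,_
    (trans (eˡ i) (cong (toPower n) (sym (trans (tail-corner X l₀ l i) (cong (λ z → corner z l i) (map-tail-zipWith-∷ x₀ x))))))
    (trans (e₀ i) (sym (trans (head-corner X l₀ l i) (cong (λ z → cornerTuple _∙_ z l₀ i) (map-head-zipWith-∷ x₀ x)))))
    where
    X = Vec.zipWith _∷_ x₀ x

  edge⇒corner : ∀ n e → E (H ^⊠ n) e → ∃[ l ] l ≢ 0ⁿ G n × CornerImage n e l
  edge⇒corner zero e ()
  edge⇒corner (suc n) e (inj₁ (same , x₀ , l₀ , l₀≢ε , e₀)) =
    l₀ ∷ 0ⁿ G n , (λ eq → l₀≢ε (Vecₚ.∷-injectiveˡ eq)) ,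
    extend n e _ (allEqual⇒trivial n (proj₁ ∘ e) same) x₀ l₀ e₀
  edge⇒corner (suc n) e (inj₂ (inj₁ (edge , same))) =
    let (l , l≢0 , image) = edge⇒corner n (proj₁ ∘ e) edge
    in ε ∷ l , (λ eq → l≢0 (Vecₚ.∷-injectiveʳ eq)) ,
       extend n e l image (proj₂ (e zero)) ε (λ i → trans (same i zero) (sym (cornerTuple-identity _∙_ identityʳ _ i)))
  edge⇒corner (suc n) e (inj₂ (inj₂ (edge , x₀ , l₀ , l₀≢ε , e₀))) =
    let (l , l≢0 , image) = edge⇒corner n (proj₁ ∘ e) edge
    in l₀ ∷ l , (λ eq → l₀≢ε (Vecₚ.∷-injectiveˡ eq)) , extend n e l image x₀ l₀ e₀

  cornerFree⇒independent : ∀ n S → CornerFree (_⊕ⁿ_ G) (0ⁿ G n) k S → Independent (H ^⊠ n) (map (toPower n) S)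
  cornerFree⇒independent n S cornerFree e edge e⊆ =
    let (l , l≢0 , x , eᵢ≡) = edge⇒corner n e edge
    in cornerFree (x , l , l≢0 , λ i → preimage (subst (_∈ _) (eᵢ≡ i) (e⊆ i)))
    where
    preimage : ∀ {y} → toPower n y ∈ map (toPower n) S → y ∈ S
    preimage y∈ = let (z , z∈S , y≡z) = ∈-map⁻ (toPower n) y∈ in subst (_∈ S) (sym (toPower-injective n y≡z)) z∈S

mainTheorem4 : (m : ℕ) (G : FinAbGroup m) (k : ℕ) → 1 ≤ k →
    ((n : ℕ) → Σ (List (Vec (Vec (Fin m) n) k)) λ S →
        Unique S × CornerFree (_⊕ⁿ_ G) (0ⁿ G n) k S
        × (k ^ k) * (m ^ (k * k * n)) ≤ (length S ^ k) * (m ^ n) * (suc k ^ suc k))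
    × ((a b : ℕ) → 1 ≤ b → a ^ k < (m ^ (k * k ∸ 1)) * (b ^ k) →
        Σ ℕ λ N → (n : ℕ) → N ≤ n →
          Σ (List (V (Hcor G k ^⊠ n))) λ S →
            Unique S × Independent (Hcor G k ^⊠ n) S × a ^ n < length S * (b ^ n))
mainTheorem4 m G zero ()
mainTheorem4 m G (suc j) _ = large-corner-free-set , large-independent-set
  where
  open StrongPowers G (suc j)
  k : ℕ
  k = suc j
  large-corner-free-set : ∀ n → ∃[ S ] Unique S × CornerFree (_⊕ⁿ_ G) (0ⁿ G n) k S
    × k ^ k * m ^ (k * k * n) ≤ length S ^ k * m ^ n * suc k ^ suc k
  large-corner-free-set n = CornerFreeSets.large-corner-free-set G n j
  large-independent-set : ∀ a b → 1 ≤ b → a ^ k < m ^ (k * k ∸ 1) * b ^ k →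
    ∃[ N₀ ] ∀ n → N₀ ≤ n → ∃[ S ] Unique S × Independent (H ^⊠ n) S × a ^ n < length S * b ^ n
  large-independent-set a b _ rate =
    let (N₀ , beats) = size-bound⇒rate j m a b (>-nonZero⁻¹ m {{nonZeroIndex (FinAbGroup.ε G)}}) rate
    in N₀ , λ n N₀≤n →
      let (S , S! , cornerFree , size) = large-corner-free-set n
      in map (toPower n) S , map⁺ (toPower-injective n) S! , cornerFree⇒independent n S cornerFree ,
         subst (λ s → a ^ n < s * b ^ n) (sym (length-map (toPower n) S)) (beats n N₀≤n (length S) size)
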